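{- Let $\alpha$ be an irrational point of $\mathbb{R}/\mathbb{Z}$ and let $\beta\in\mathbb{Q}/\mathbb{Z}$. Then $\chi_\beta(\alpha)=1$ if and only if $\beta\in E_n(\alpha)$ for some $n\ge1$. Moreover, for every positive integer $Q$, $$\sum_{h(\beta)\le Q}\chi_\beta(\alpha)=\sum_{q=1}^QX_q(\alpha),$$ and this sum equals the number of elements of $\bigcup_{n\ge1}E_n(\alpha)$ of height at most $Q$, i.e. the number of convergents and intermediate convergents of $\alpha$ with height at most $Q$.
   Context: Every $\beta\in\mathbb{Q}/\mathbb{Z}$ can be written $\beta=a/q$ with $q\ge1$ and $\gcd(a,q)=1$; its height is $h(\beta)=q$. Put $\mathcal{F}_Q=\{\beta:h(\beta)\le Q\}$. For distinct $a,b\in\mathbb{R}/\mathbb{Z}$, $I(a,b)$ is the open arc from $a$ to $b$ in the positive direction, i.e. $\{a+t\bmod 1:0<t<d\}$ with $d\in(0,1)$, $d\equiv b-a$. $\overline{I}(a,b)$ is its closure. For $\beta\ne0$ with $h(\beta)=Q$: $\beta'$ is the unique point of $\mathcal{F}_Q$ with $I(\beta',\beta)\cap\mathcal{F}_Q=\emptyset$, and $\beta''$ is the unique point of $\mathcal{F}_Q$ with $I(\beta,\beta'')\cap\mathcal{F}_Q=\emptyset$. Define $\chi_0\equiv1$. For $\beta\ne0$ let $\chi_\beta(x)=1$ for $x\in I(\beta',\beta'')$, $\chi_\beta(x)=\tfrac12$ for $x\in\{\beta',\beta''\}$, and $\chi_\beta(x)=0$ for $x\notin\overline{I}(\beta',\beta'')$.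 Put $X_q(x)=\sum_{h(\beta)=q}\chi_\beta(x)$. Identify an irrational $\alpha$ with its representative in $(0,1)$ and write $\alpha=[0;a_1,a_2,\dots]$. Set $p_{ -2}=0$, $q_{ -2}=1$, $p_{ -1}=1$, $q_{ -1}=0$, and for $n\ge0$ set $p_n=a_np_{n-1}+p_{n-2}$ and $q_n=a_nq_{n-1}+q_{n-2}$, with $a_0=0$. For $n\ge1$, $E_n(\alpha)=\{(mp_{n-1}+p_{n-2})/(mq_{n-1}+q_{n-2}):1\le m\le a_n\}\subset\mathbb{Q}/\mathbb{Z}$. -}

module Defs where

open import Data.Bool using (Bool; true; false; if_then_else_; _∧_; _∨_; not)
open import Data.Nat as ℕ using (ℕ; zero; suc)
open import Data.Integer as ℤ using (ℤ; +_)
open import Data.Rational as ℚ using (ℚ; 0ℚ; 1ℚ; ½)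
open import Data.Rational.Properties as ℚP using ()
open import Data.List using (List; []; _∷_; filter; concatMap; upTo; map; foldr)
open import Data.Product using (_×_; _,_; Σ; ∃)
open import Data.Sum using (_⊎_)
open import Relation.Nullary.Decidable using (does)
open import Relation.Binary.PropositionalEquality using (_≡_; _≢_)

-- ℚ/ℤ is represented by the rationals β with 0 ≤ β < 1 (the canonical
-- representative).  Since ℚ is normalised, the height h(β)=q of
-- β = a/q (gcd(a,q)=1) is the stdlib denominator.

height : ℚ → ℕ
height = ℚ.ℚ.denominatorℕ

modOne : ℚ → ℚ
modOne p = p ℚ.- (ℚ.floor p ℚ./ 1)

-- the rational p/q (with 0 for q = 0, never used for q = 0 below)
frac : ℕ → ℕ → ℚ
frac p zero    = 0ℚ
frac p (suc k) = (+ p) ℚ./ suc k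

_<ᵇ_ : ℚ → ℚ → Bool
r <ᵇ s = does (r ℚP.<? s)

_==_ : ℚ → ℚ → Bool
r == s = does (r ℚP.≟ s)

-- Points of all rationals i/q, 1 ≤ q ≤ Q, 0 ≤ i < q, kept only when in lowest
-- terms with denominator q, so each β ∈ ℚ/ℤ with h(β)=q appears once.
ofHeight : ℕ → List ℚ
ofHeight q = filter (λ β → height β ℕ.≟ q) (map (λ i → frac i q) (upTo q))

farey : ℕ → List ℚ
farey Q = concatMap (λ q → ofHeight (suc q)) (upTo Q)

-- A point x of ℝ/ℤ with representative in [0,1) is given by its
-- comparison with every rational: cmp r = less / equal / greater
-- according as r < x, r = x, r > x.

data Cmp : Set where
  less equal greater : Cmp

Point : Set
Point = ℚ → Cmp

isLess isEqual isGreater : Cmp → Bool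
isLess less = true
isLess _    = false
isEqual equal = true
isEqual _     = false
isGreater greater = true
isGreater _       = false

ratPt : ℚ → Point
ratPt x r = if r <ᵇ x then less else (if r == x then equal else greater)

-- x ∈ I(a,b), the open positive arc from a to b, for a,b ∈ [0,1)
inArc : ℚ → ℚ → Point → Bool
inArc a b x =
  if a <ᵇ b then isLess (x a) ∧ isGreater (x b)
            else isLess (x a) ∨ isGreater (x b)

allB : (ℚ → Bool) → List ℚ → Bool
allB p []      = true
allB p (x ∷ xs) = p x ∧ allB p xs

head0 : List ℚ → ℚ
head0 []      = 0ℚ
head0 (x ∷ _) = x

leftNbr : ℚ → ℚ
leftNbr β = head0 (filter (λ γ → T? (not (γ == β) ∧ allB (λ δ → not (inArc γ β (ratPt δ))) F)) F)
  where
    F = farey (height β)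
    open import Data.Bool.Properties using (T?)

rightNbr : ℚ → ℚ
rightNbr β = head0 (filter (λ γ → T? (not (γ == β) ∧ allB (λ δ → not (inArc β γ (ratPt δ))) F)) F)
  where
    F = farey (height β)
    open import Data.Bool.Properties using (T?)

χ : ℚ → Point → ℚ
χ β x =
  if β == 0ℚ then 1ℚ
  else if inArc (leftNbr β) (rightNbr β) x then 1ℚ
  else if isEqual (x (leftNbr β)) ∨ isEqual (x (rightNbr β)) then ½
  else 0ℚ

sumℚ : List ℚ → ℚ
sumℚ = foldr ℚ._+_ 0ℚ

X : ℕ → Point → ℚ
X q x = sumℚ (map (λ β → χ β x) (ofHeight q))

sumχ : ℕ → Point → ℚ
sumχ Q x = sumχ' (farey Q)
  where sumχ' : List ℚ → ℚ
        sumχ' l = sumℚ (map (λ β → χ β x) l)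

sumX : ℕ → Point → ℚ
sumX Q x = sumℚ (map (λ q → X (suc q) x) (upTo Q))

record IrrationalPoint (α : Point) : Set where
  field
    never-equal : ∀ r → α r ≢ equal
    lower-closed : ∀ r s → r ℚ.≤ s → α s ≡ less → α r ≡ less
    upper-closed : ∀ r s → r ℚ.≤ s → α r ≡ greater → α s ≡ greater
    lower-open : ∀ r → α r ≡ less → ∃ λ s → r ℚ.< s × α s ≡ less
    upper-open : ∀ r → α r ≡ greater → ∃ λ s → s ℚ.< r × α s ≡ greater
    zero-below : α 0ℚ ≡ less
    one-above  : α 1ℚ ≡ greater

-- Continued fraction data: a n = a_n (a 0 = a_0 = 0).
-- P k = p_{k-2}, Qd k = q_{k-2}.
P : (ℕ → ℕ) → ℕ → ℕ
P a zero          = 0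
P a (suc zero)    = 1
P a (suc (suc k)) = a k ℕ.* P a (suc k) ℕ.+ P a k

Qd : (ℕ → ℕ) → ℕ → ℕ
Qd a zero          = 1
Qd a (suc zero)    = 0
Qd a (suc (suc k)) = a k ℕ.* Qd a (suc k) ℕ.+ Qd a k

convergent : (ℕ → ℕ) → ℕ → ℚ
convergent a n = frac (P a (2 ℕ.+ n)) (Qd a (2 ℕ.+ n))

record IsCFExpansion (a : ℕ → ℕ) (α : Point) : Set where
  field
    a₀ : a 0 ≡ 0
    positive : ∀ n → 1 ℕ.≤ a (suc n)
    converges : ∀ (ε : ℚ) → 0ℚ ℚ.< ε → ∃ λ N → ∀ n → N ℕ.≤ n →
                  α (convergent a n ℚ.- ε) ≡ less × α (convergent a n ℚ.+ ε) ≡ greater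

_∈E[_,_] : ℚ → ℕ → (ℕ → ℕ) → Set
β ∈E[ n , a ] = ∃ λ m → 1 ℕ.≤ m × m ℕ.≤ a n ×
  modOne (frac (m ℕ.* P a (suc n) ℕ.+ P a n) (m ℕ.* Qd a (suc n) ℕ.+ Qd a n)) ≡ β

_∈⋃E_ : ℚ → (ℕ → ℕ) → Set
β ∈⋃E a = ∃ λ n → 1 ℕ.≤ n × β ∈E[ n , a ]

IsQZ : ℚ → Set
IsQZ β = 0ℚ ℚ.≤ β × β ℚ.< 1ℚ

{-# OPTIONS --safe #-}
-- A nonzero β ∈ (0,1) of height Q is the mediant ℓ ⊕ u of its Stern–Brocot parents ℓ ⋖ u,
-- and every other fraction strictly between ℓ and u has denominator larger than Q. So ℓ and
-- u are the neighbours β′, β″ of β in F_Q (β″ = 0 when u = 1), and, α being irrational,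
-- χ_β(α) is 1 when ℓ < α < u and 0 otherwise. The intermediate fractions of α are the
-- successive mediants on the Stern–Brocot path of α, and their parents lie on either side
-- of α. Conversely, if ℓ < α < u, walking down that path keeps β and α in a common interval
-- until β appears as a mediant. As χ_β(α) ∈ {0, 1}, the sum over F_Q counts these fractions.
module Submission where

open import Defs
open import Data.Nat as ℕ using (ℕ; zero; suc; _+_; _*_; _∸_; _≤_; _<_; s≤s; z≤n)
import Data.Nat.Properties as ℕP
import Data.Nat.DivMod as ℕDM
import Data.Sign as Sign
open import Data.Nat.Tactic.RingSolver using (solve-∀)
open import Data.Integer as ℤ using (+_; -[1+_])
import Data.Integer.Properties as ℤP
open import Data.Integer.GCD using () renaming (gcd to ℤgcd)
open import Data.Rational as ℚ using (ℚ; mkℚ; 0ℚ; 1ℚ; ½; _/_)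
import Data.Rational.Properties as ℚP
open import Data.Rational.Solver using (module +-*-Solver)
open import Data.Rational.Unnormalised as ℚᵘ using (mkℚᵘ)
import Data.Rational.Unnormalised.Properties as ℚᵘP
open import Data.List using (List; []; _∷_; _++_; map; concatMap; upTo; filter; length)
import Data.List.Properties as ListP
open import Data.List.Membership.Propositional using (_∈_; find; lose)
open import Data.List.Membership.Propositional.Properties
  using (∈-concatMap⁻; ∈-concatMap⁺; ∈-filter⁻; ∈-filter⁺; ∈-map⁻; ∈-map⁺; ∈-upTo⁻; ∈-upTo⁺)
open import Data.List.Relation.Unary.Any using (here; there)
import Data.List.Relation.Unary.All as All
import Data.List.Relation.Unary.All.Properties as AllP
import Data.List.Relation.Unary.AllPairs as AllPairs
import Data.List.Relation.Unary.AllPairs.Properties as AllPairsP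
open import Data.List.Relation.Unary.Unique.Propositional using (Unique)
import Data.List.Relation.Unary.Unique.Propositional.Properties as UniqueP
open import Data.Product using (_×_; _,_; proj₁; proj₂; ∃; Σ-syntax)
open import Data.Sum using (_⊎_; inj₁; inj₂; [_,_]′)
open import Data.Empty using (⊥-elim)
open import Data.Bool using (Bool; true; false; T; not; _∧_; _∨_; if_then_else_)
open import Data.Bool.Properties using (T-∧; T-∨; T?)
open import Data.Unit using (tt)
open import Data.Product.Function.NonDependent.Propositional using (_×-⇔_)
open import Data.Sum.Function.Propositional using (_⊎-⇔_)
open import Function using (const; _∘_)
open import Function.Bundles using (_⇔_; mk⇔; Equivalence)
import Function.Properties.Equivalence as ⇔
open import Relation.Nullary using (¬_; Dec; yes; no; does)
open import Relation.Nullary.Decidable using (dec-true; dec-false)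
open import Relation.Binary.Definitions using (tri<; tri≈; tri>)
open import Relation.Binary.PropositionalEquality

open Equivalence using (to; from)

-- Fractions as pairs of naturals, mediants and Farey pairs

Pair : Set
Pair = ℕ × ℕ

nm dn : Pair → ℕ
nm = proj₁
dn = proj₂

⟦_⟧ : Pair → ℚ
⟦ X ⟧ = frac (nm X) (dn X)

data Pos : Pair → Set where
  pos : ∀ {p q} → Pos (p , suc q)

≥1⇒Pos : ∀ {X} → 1 ≤ dn X → Pos X
≥1⇒Pos {_ , suc _} _ = pos

Pos⇒≥1 : ∀ {X} → Pos X → 1 ≤ dn X
Pos⇒≥1 pos = s≤s z≤n

_<ₓ_ _≈ₓ_ : Pair → Pair → Set
X <ₓ Y = nm X * dn Y < nm Y * dn X
X ≈ₓ Y = nm X * dn Y ≡ nm Y * dn X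

<ₓ⇒< : ∀ {X Y} → Pos X → Pos Y → X <ₓ Y → ⟦ X ⟧ ℚ.< ⟦ Y ⟧
<ₓ⇒< (pos {x} {k}) (pos {y} {l}) lt = ℚP.toℚᵘ-cancel-<
  (ℚᵘP.<-respʳ-≃ (ℚᵘP.≃-sym (ℚP.toℚᵘ-fromℚᵘ (mkℚᵘ (+ y) l)))
    (ℚᵘP.<-respˡ-≃ (ℚᵘP.≃-sym (ℚP.toℚᵘ-fromℚᵘ (mkℚᵘ (+ x) k)))
      (ℚᵘ.*<* (subst₂ ℤ._<_ (ℤP.pos-* x (suc l)) (ℤP.pos-* y (suc k)) (ℤ.+<+ lt)))))

≈ₓ⇒≡ : ∀ {X Y} → Pos X → Pos Y → X ≈ₓ Y → ⟦ X ⟧ ≡ ⟦ Y ⟧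
≈ₓ⇒≡ (pos {x} {k}) (pos {y} {l}) e = ℚP.toℚᵘ-injective
  (ℚᵘP.≃-trans (ℚP.toℚᵘ-fromℚᵘ (mkℚᵘ (+ x) k))
    (ℚᵘP.≃-trans (ℚᵘ.*≡* (trans (sym (ℤP.pos-* x (suc l))) (trans (cong +_ e) (ℤP.pos-* y (suc k)))))
      (ℚᵘP.≃-sym (ℚP.toℚᵘ-fromℚᵘ (mkℚᵘ (+ y) l)))))

<⇒<ₓ : ∀ {X Y} → Pos X → Pos Y → ⟦ X ⟧ ℚ.< ⟦ Y ⟧ → X <ₓ Y
<⇒<ₓ {X} {Y} pX pY lt with ℕP.<-cmp (nm X * dn Y) (nm Y * dn X)
... | tri< X<Y _ _ = X<Y
... | tri≈ _ X≈Y _ = ⊥-elim (ℚP.<-irrefl (≈ₓ⇒≡ pX pY X≈Y) lt)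
... | tri> _ _ Y<X = ⊥-elim (ℚP.<-asym lt (<ₓ⇒< pY pX Y<X))

≡⇒≈ₓ : ∀ {X Y} → Pos X → Pos Y → ⟦ X ⟧ ≡ ⟦ Y ⟧ → X ≈ₓ Y
≡⇒≈ₓ {X} {Y} pX pY e with ℕP.<-cmp (nm X * dn Y) (nm Y * dn X)
... | tri< X<Y _ _ = ⊥-elim (ℚP.<⇒≢ (<ₓ⇒< pX pY X<Y) e)
... | tri≈ _ X≈Y _ = X≈Y
... | tri> _ _ Y<X = ⊥-elim (ℚP.<⇒≢ (<ₓ⇒< pY pX Y<X) (sym e))

_⊕_ : Pair → Pair → Pair
X ⊕ Y = (nm X + nm Y , dn X + dn Y)

⊕-comm : ∀ X Y → X ⊕ Y ≡ Y ⊕ X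
⊕-comm (x₁ , x₂) (y₁ , y₂) = cong₂ _,_ (ℕP.+-comm x₁ y₁) (ℕP.+-comm x₂ y₂)

Pos-⊕ : ∀ {X} Y → Pos X → Pos (X ⊕ Y)
Pos-⊕ {X} Y p = ≥1⇒Pos (ℕP.≤-trans (Pos⇒≥1 p) (ℕP.m≤m+n (dn X) (dn Y)))

iterMediant : ℕ → Pair → Pair → Pair
iterMediant k C X = (k * nm C + nm X , k * dn C + dn X)

iterMediant-suc : ∀ k C X → iterMediant (suc k) C X ≡ C ⊕ iterMediant k C X
iterMediant-suc k (c₁ , c₂) (x₁ , x₂) =
  cong₂ _,_ (ℕP.+-assoc c₁ (k * c₁) x₁) (ℕP.+-assoc c₂ (k * c₂) x₂)

Pos-iterMediant : ∀ {X} k C → Pos X → Pos (iterMediant k C X)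
Pos-iterMediant {X} k C p = ≥1⇒Pos (ℕP.≤-trans (Pos⇒≥1 p) (ℕP.m≤n+m (dn X) (k * dn C)))

Pos-iterMediant-suc : ∀ {C} k X → Pos C → Pos (iterMediant (suc k) C X)
Pos-iterMediant-suc {C} k X p = subst Pos (sym (iterMediant-suc k C X)) (Pos-⊕ (iterMediant k C X) p)

record _⋖_ (X Y : Pair) : Set where
  constructor mk⋖
  field det : nm Y * dn X ≡ nm X * dn Y + 1

Adjacent : Pair → Pair → Set
Adjacent X Y = X ⋖ Y ⊎ Y ⋖ X

Adjacent-sym : ∀ {X Y} → Adjacent X Y → Adjacent Y X
Adjacent-sym (inj₁ d) = inj₂ d
Adjacent-sym (inj₂ d) = inj₁ d

⋖⇒<ₓ : ∀ {X Y} → X ⋖ Y → X <ₓ Y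
⋖⇒<ₓ {X} (mk⋖ e) rewrite e = ℕP.≤-reflexive (ℕP.+-comm 1 (nm X * _))

⋖⇒< : ∀ {X Y} → Pos X → Pos Y → X ⋖ Y → ⟦ X ⟧ ℚ.< ⟦ Y ⟧
⋖⇒< pX pY d = <ₓ⇒< pX pY (⋖⇒<ₓ d)

⋖-⊕ˡ : ∀ {X Y} → X ⋖ Y → X ⋖ (X ⊕ Y)
⋖-⊕ˡ {x₁ , x₂} {y₁ , y₂} (mk⋖ e) = mk⋖ (begin
    (x₁ + y₁) * x₂          ≡⟨ l₁ x₁ y₁ x₂ ⟩
    x₁ * x₂ + y₁ * x₂       ≡⟨ cong (λ t → x₁ * x₂ + t) e ⟩
    x₁ * x₂ + (x₁ * y₂ + 1) ≡⟨ l₂ x₁ x₂ y₂ ⟩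
    x₁ * (x₂ + y₂) + 1      ∎)
  where
    open ≡-Reasoning
    l₁ : ∀ x₁ y₁ x₂ → (x₁ + y₁) * x₂ ≡ x₁ * x₂ + y₁ * x₂
    l₁ = solve-∀
    l₂ : ∀ x₁ x₂ y₂ → x₁ * x₂ + (x₁ * y₂ + 1) ≡ x₁ * (x₂ + y₂) + 1
    l₂ = solve-∀

⋖-⊕ʳ : ∀ {X Y} → X ⋖ Y → (X ⊕ Y) ⋖ Y
⋖-⊕ʳ {x₁ , x₂} {y₁ , y₂} (mk⋖ e) = mk⋖ (begin
    y₁ * (x₂ + y₂)          ≡⟨ l₁ y₁ x₂ y₂ ⟩
    y₁ * y₂ + y₁ * x₂       ≡⟨ cong (λ t → y₁ * y₂ + t) e ⟩
    y₁ * y₂ + (x₁ * y₂ + 1) ≡⟨ l₂ x₁ y₁ y₂ ⟩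
    (x₁ + y₁) * y₂ + 1      ∎)
  where
    open ≡-Reasoning
    l₁ : ∀ y₁ x₂ y₂ → y₁ * (x₂ + y₂) ≡ y₁ * y₂ + y₁ * x₂
    l₁ = solve-∀
    l₂ : ∀ x₁ y₁ y₂ → y₁ * y₂ + (x₁ * y₂ + 1) ≡ (x₁ + y₁) * y₂ + 1
    l₂ = solve-∀

Adjacent-iterMediant : ∀ {C X} k → Adjacent C X → Adjacent C (iterMediant k C X)
Adjacent-iterMediant zero a = a
Adjacent-iterMediant {C} {X} (suc k) a with Adjacent-iterMediant k a
... | inj₁ d = inj₁ (subst (C ⋖_) (sym (iterMediant-suc k C X)) (⋖-⊕ˡ d))
... | inj₂ d = inj₂ (subst (_⋖ C) (trans (⊕-comm _ C) (sym (iterMediant-suc k C X))) (⋖-⊕ʳ d))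

-- Z = u X + v Y with u, v ≥ 1 the two cross-determinants, so dn Z = u dn X + v dn Y.
⋖-dn-bound : ∀ {X Y} Z → X ⋖ Y → X <ₓ Z → Z <ₓ Y → dn X + dn Y ≤ dn Z
⋖-dn-bound {nX , dX} {nY , dY} (nZ , dZ) (mk⋖ e) X<Z Z<Y
  with v , eᵥ ← ℕP.m≤n⇒∃[o]m+o≡n X<Z | u , eᵤ ← ℕP.m≤n⇒∃[o]m+o≡n Z<Y =
  ℕP.≤-trans (ℕP.+-mono-≤ (ℕP.m≤m*n dX (suc u)) (ℕP.m≤m*n dY (suc v))) (ℕP.≤-reflexive dZ≡)
  where
    open ≡-Reasoning
    s₁ : ∀ a b c → a * b * c + c ≡ (a * b + 1) * c
    s₁ = solve-∀
    s₂ : ∀ a b c → a * b * c ≡ b * (a * c)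
    s₂ = solve-∀
    s₃ : ∀ dX nZ dY u → dX * (suc (nZ * dY) + u) ≡ dY * (nZ * dX) + dX * suc u
    s₃ = solve-∀
    s₄ : ∀ nX dY dZ v dX u →
         dY * (suc (nX * dZ) + v) + dX * suc u ≡ nX * dY * dZ + (dX * suc u + dY * suc v)
    s₄ = solve-∀
    dZ≡ : dX * suc u + dY * suc v ≡ dZ
    dZ≡ = sym (ℕP.+-cancelˡ-≡ (nX * dY * dZ) _ _ (begin
      nX * dY * dZ + dZ                     ≡⟨ s₁ nX dY dZ ⟩
      (nX * dY + 1) * dZ                    ≡⟨ cong (_* dZ) (sym e) ⟩
      nY * dX * dZ                          ≡⟨ s₂ nY dX dZ ⟩
      dX * (nY * dZ)                        ≡⟨ cong (dX *_) (sym eᵤ) ⟩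
      dX * (suc (nZ * dY) + u)              ≡⟨ s₃ dX nZ dY u ⟩
      dY * (nZ * dX) + dX * suc u           ≡⟨ cong (λ t → dY * t + dX * suc u) (sym eᵥ) ⟩
      dY * (suc (nX * dZ) + v) + dX * suc u ≡⟨ s₄ nX dY dZ v dX u ⟩
      nX * dY * dZ + (dX * suc u + dY * suc v) ∎))

<⇒≱ : ∀ {p q} → p ℚ.< q → ¬ q ℚ.≤ p
<⇒≱ p<q q≤p = ℚP.<-irrefl refl (ℚP.<-≤-trans p<q q≤p)

≮∧≢⇒> : ∀ {p q} → ¬ p ℚ.< q → p ≢ q → q ℚ.< p
≮∧≢⇒> {p} {q} p≮q p≢q with ℚP.<-cmp p q
... | tri< p<q _ _ = ⊥-elim (p≮q p<q)
... | tri≈ _ p≡q _ = ⊥-elim (p≢q p≡q)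
... | tri> _ _ q<p = q<p

0<1 : 0ℚ ℚ.< 1ℚ
0<1 = ℚP.positive⁻¹ 1ℚ

Between : ℚ → ℚ → ℚ → Set
Between a b c = (a ℚ.< b × b ℚ.< c) ⊎ (c ℚ.< b × b ℚ.< a)

Between-sym : ∀ {a b c} → Between a b c → Between c b a
Between-sym (inj₁ (p , q)) = inj₂ (p , q)
Between-sym (inj₂ (p , q)) = inj₁ (p , q)

Between-widen : ∀ {c y z w} → Between c z w → Between c y z → Between c y w
Between-widen (inj₁ (_ , z<w)) (inj₁ (c<y , y<z)) = inj₁ (c<y , ℚP.<-trans y<z z<w)
Between-widen (inj₁ (c<z , _)) (inj₂ (z<y , y<c)) = ⊥-elim (ℚP.<-asym c<z (ℚP.<-trans z<y y<c))
Between-widen (inj₂ (_ , z<c)) (inj₁ (c<y , y<z)) = ⊥-elim (ℚP.<-asym z<c (ℚP.<-trans c<y y<z))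
Between-widen (inj₂ (w<z , _)) (inj₂ (z<y , y<c)) = inj₂ (ℚP.<-trans w<z z<y , y<c)

Between-split : ∀ {x y m b} → Between x b y → Between x m y → b ≢ m → Between x b m ⊎ Between m b y
Between-split (inj₁ (x<b , b<y)) (inj₂ (y<m , m<x)) _ =
  ⊥-elim (ℚP.<-asym (ℚP.<-trans x<b b<y) (ℚP.<-trans y<m m<x))
Between-split (inj₂ (y<b , b<x)) (inj₁ (x<m , m<y)) _ =
  ⊥-elim (ℚP.<-asym (ℚP.<-trans y<b b<x) (ℚP.<-trans x<m m<y))
Between-split {m = m} {b} (inj₁ (x<b , b<y)) (inj₁ _) b≢m with ℚP.<-cmp b m
... | tri< b<m _ _ = inj₁ (inj₁ (x<b , b<m))
... | tri≈ _ b≡m _ = ⊥-elim (b≢m b≡m)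
... | tri> _ _ m<b = inj₂ (inj₁ (m<b , b<y))
Between-split {m = m} {b} (inj₂ (y<b , b<x)) (inj₂ _) b≢m with ℚP.<-cmp b m
... | tri< b<m _ _ = inj₂ (inj₂ (y<b , b<m))
... | tri≈ _ b≡m _ = ⊥-elim (b≢m b≡m)
... | tri> _ _ m<b = inj₁ (inj₂ (m<b , b<x))

⋖-mediant-between : ∀ {X Y} → Pos X → Pos Y → X ⋖ Y →
  ⟦ X ⟧ ℚ.< ⟦ X ⊕ Y ⟧ × ⟦ X ⊕ Y ⟧ ℚ.< ⟦ Y ⟧
⋖-mediant-between {Y = Y} pX pY d =
  ⋖⇒< pX (Pos-⊕ Y pX) (⋖-⊕ˡ d) , ⋖⇒< (Pos-⊕ Y pX) pY (⋖-⊕ʳ d)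

mediant-between : ∀ {X Y} → Pos X → Pos Y → Adjacent X Y → Between ⟦ X ⟧ ⟦ X ⊕ Y ⟧ ⟦ Y ⟧
mediant-between pX pY (inj₁ d) = inj₁ (⋖-mediant-between pX pY d)
mediant-between {X} {Y} pX pY (inj₂ d) =
  subst (λ Z → Between ⟦ X ⟧ ⟦ Z ⟧ ⟦ Y ⟧) (⊕-comm Y X) (inj₂ (⋖-mediant-between pY pX d))

iterMediant-between : ∀ {C X} → Pos C → Adjacent C X → ∀ k → Pos (iterMediant k C X) →
  ∀ j → Between ⟦ C ⟧ ⟦ iterMediant (suc j + k) C X ⟧ ⟦ iterMediant k C X ⟧
iterMediant-between {C} {X} pC adj k pₖ zero =
  subst (λ Z → Between ⟦ C ⟧ ⟦ Z ⟧ ⟦ iterMediant k C X ⟧) (sym (iterMediant-suc k C X))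
    (mediant-between pC pₖ (Adjacent-iterMediant k adj))
iterMediant-between {C} {X} pC adj k pₖ (suc j) =
  Between-widen (iterMediant-between pC adj k pₖ j) (subst (λ Z → Between ⟦ C ⟧ ⟦ Z ⟧ ⟦ M ⟧)
    (sym (iterMediant-suc (suc j + k) C X))
    (mediant-between pC (Pos-iterMediant-suc (j + k) X pC) (Adjacent-iterMediant (suc j + k) adj)))
  where M = iterMediant (suc j + k) C X

pairOf : ℚ → Pair
pairOf β = (ℤ.∣ ℚ.↥ β ∣ , height β)

Pos-pairOf : ∀ β → Pos (pairOf β)
Pos-pairOf β = pos

⟦pairOf⟧ : ∀ β → 0ℚ ℚ.≤ β → ⟦ pairOf β ⟧ ≡ β
⟦pairOf⟧ β@(mkℚ (+ _) _ _) _ = ℚP.↥p/↧p≡p β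
⟦pairOf⟧ (mkℚ -[1+ _ ] _ _) (ℚ.*≤* ())

⟦⟧-nonneg : ∀ {X} → Pos X → 0ℚ ℚ.≤ ⟦ X ⟧
⟦⟧-nonneg pX = ℚP.≮⇒≥ (λ lt → ℕP.n≮0 (<⇒<ₓ pX (pos {0} {0}) lt))

nm<dn⇒<1 : ∀ {X} → Pos X → nm X < dn X → ⟦ X ⟧ ℚ.< 1ℚ
nm<dn⇒<1 {X} pX lt =
  <ₓ⇒< pX (pos {1} {0}) (subst₂ _<_ (sym (ℕP.*-identityʳ (nm X))) (sym (ℕP.*-identityˡ (dn X))) lt)

<1⇒nm<dn : ∀ {X} → Pos X → ⟦ X ⟧ ℚ.< 1ℚ → nm X < dn X
<1⇒nm<dn {X} pX lt = subst₂ _<_ (ℕP.*-identityʳ (nm X)) (ℕP.*-identityˡ (dn X)) (<⇒<ₓ pX (pos {1} {0}) lt)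

nm≡dn⇒≡1 : ∀ {X} → Pos X → nm X ≡ dn X → ⟦ X ⟧ ≡ 1ℚ
nm≡dn⇒≡1 {X} pX e =
  ≈ₓ⇒≡ pX (pos {1} {0}) (trans (ℕP.*-identityʳ (nm X)) (trans e (sym (ℕP.*-identityˡ (dn X)))))

height-⟦⟧ : ∀ {X} → Pos X → height ⟦ X ⟧ ≤ dn X
height-⟦⟧ (pos {x} {k}) = divides-suc (height (frac x (suc k))) ℤ.∣ ℤgcd (+ x) (+ suc k) ∣
  (trans (sym (ℤP.abs-* (ℚ.↧ (frac x (suc k))) (ℤgcd (+ x) (+ suc k))))
         (cong ℤ.∣_∣ (ℚP.↧-normalize x (suc k))))
  where
    divides-suc : ∀ d g {n} → d * g ≡ suc n → d ≤ suc n
    divides-suc d zero e = ⊥-elim (ℕP.0≢1+n (trans (sym (ℕP.*-zeroʳ d)) e))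
    divides-suc d (suc g) e = ℕP.≤-trans (ℕP.m≤m*n d (suc g)) (ℕP.≤-reflexive e)

⋖-height-bound : ∀ {X Y β} → Pos X → Pos Y → X ⋖ Y → ⟦ X ⟧ ℚ.< β → β ℚ.< ⟦ Y ⟧ →
  dn X + dn Y ≤ height β
⋖-height-bound {β = β} pX pY d X<β β<Y = ⋖-dn-bound (pairOf β) d
  (<⇒<ₓ pX (Pos-pairOf β) (subst (_ ℚ.<_) (sym β≡) X<β))
  (<⇒<ₓ (Pos-pairOf β) pY (subst (ℚ._< _) (sym β≡) β<Y))
  where β≡ = ⟦pairOf⟧ β (ℚP.<⇒≤ (ℚP.≤-<-trans (⟦⟧-nonneg pX) X<β))

Adjacent-height-bound : ∀ {X Y β} → Pos X → Pos Y → Adjacent X Y → Between ⟦ X ⟧ β ⟦ Y ⟧ →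
  dn X + dn Y ≤ height β
Adjacent-height-bound pX pY (inj₁ d) (inj₁ (X<β , β<Y)) = ⋖-height-bound pX pY d X<β β<Y
Adjacent-height-bound pX pY (inj₁ d) (inj₂ (Y<β , β<X)) =
  ⊥-elim (ℚP.<-asym (⋖⇒< pX pY d) (ℚP.<-trans Y<β β<X))
Adjacent-height-bound pX pY (inj₂ d) (inj₁ (X<β , β<Y)) =
  ⊥-elim (ℚP.<-asym (⋖⇒< pY pX d) (ℚP.<-trans X<β β<Y))
Adjacent-height-bound {X} {Y} {β} pX pY (inj₂ d) (inj₂ (Y<β , β<X)) =
  subst (_≤ height β) (ℕP.+-comm (dn Y) (dn X)) (⋖-height-bound pY pX d Y<β β<X)

pairOf-mediant : ∀ {X Y} → Pos X → Pos Y → X ⋖ Y → pairOf ⟦ X ⊕ Y ⟧ ≡ X ⊕ Y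
pairOf-mediant {X} {Y} pX pY d = cong₂ _,_ nm≡ height≡
  where
    M = X ⊕ Y
    pM = Pos-⊕ Y pX
    X<M<Y = ⋖-mediant-between pX pY d
    height≡ : height ⟦ M ⟧ ≡ dn M
    height≡ = ℕP.≤-antisym (height-⟦⟧ pM) (⋖-height-bound pX pY d (proj₁ X<M<Y) (proj₂ X<M<Y))
    nm≡ : nm (pairOf ⟦ M ⟧) ≡ nm M
    nm≡ = ℕP.*-cancelʳ-≡ _ _ (dn M) {{ℕ.>-nonZero (Pos⇒≥1 pM)}}
      (trans (≡⇒≈ₓ (Pos-pairOf ⟦ M ⟧) pM (⟦pairOf⟧ ⟦ M ⟧ (⟦⟧-nonneg pM))) (cong (nm M *_) height≡))

-- Farey lists

∈-ofHeight⇒height : ∀ {q β} → β ∈ ofHeight q → height β ≡ q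
∈-ofHeight⇒height {q} m = proj₂ (∈-filter⁻ (λ γ → height γ ℕ.≟ q) {xs = map (λ i → frac i q) (upTo q)} m)

farey-sound : ∀ {Q β} → β ∈ farey Q → IsQZ β × height β ≤ Q
farey-sound {Q} m
  with q , q<Q , m′ ← find (∈-concatMap⁻ (λ q → ofHeight (suc q)) {xs = upTo Q} m)
  with m″ , _ ← ∈-filter⁻ (λ γ → height γ ℕ.≟ suc q) {xs = map (λ i → frac i (suc q)) (upTo (suc q))} m′
  with i , i<q , refl ← ∈-map⁻ (λ i → frac i (suc q)) m″ =
  (⟦⟧-nonneg (pos {i} {q}) , nm<dn⇒<1 (pos {i} {q}) (∈-upTo⁻ i<q)) ,
  subst (_≤ Q) (sym (∈-ofHeight⇒height {suc q} m′)) (∈-upTo⁻ q<Q)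

IsQZ⇒nm<dn : ∀ {β} → IsQZ β → nm (pairOf β) < height β
IsQZ⇒nm<dn {β} (0≤β , β<1) = <1⇒nm<dn (Pos-pairOf β) (subst (ℚ._< 1ℚ) (sym (⟦pairOf⟧ β 0≤β)) β<1)

modOne-id : ∀ {β} → IsQZ β → modOne β ≡ β
modOne-id {β@(mkℚ (+ _) _ _)} qz =
  trans (cong (λ z → β ℚ.- (z / 1)) floor≡0) (ℚP.+-identityʳ β)
  where
    -- ℚ.floor of a nonnegative β computes to this form.
    floor≡0 : ℚ.floor β ≡ + 0
    floor≡0 = cong (λ k → (Sign.+ ℤ.◃ 1) ℤ.* (+ k)) (ℕDM.m<n⇒m/n≡0 (IsQZ⇒nm<dn qz))
modOne-id {mkℚ -[1+ _ ] _ _} (ℚ.*≤* () , _)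

farey-complete : ∀ {Q β} → IsQZ β → height β ≤ Q → β ∈ farey Q
farey-complete {Q} {β} qz@(0≤β , _) h≤Q =
  ∈-concatMap⁺ (λ q → ofHeight (suc q)) {xs = upTo Q} (lose (∈-upTo⁺ h≤Q) β∈ofHeight)
  where
    β≡ = ⟦pairOf⟧ β 0≤β
    β∈ofHeight : β ∈ ofHeight (height β)
    β∈ofHeight = ∈-filter⁺ (λ γ → height γ ℕ.≟ height β)
      (subst (_∈ map (λ i → frac i (height β)) (upTo (height β))) β≡
        (∈-map⁺ (λ i → frac i (height β)) (∈-upTo⁺ (IsQZ⇒nm<dn qz))))
      refl

ofHeight-unique : ∀ q → Unique (ofHeight (suc q))
ofHeight-unique q =
  UniqueP.filter⁺ (λ γ → height γ ℕ.≟ suc q) (UniqueP.map⁺ frac-injective (UniqueP.upTo⁺ (suc q)))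
  where
    frac-injective : ∀ {i j} → frac i (suc q) ≡ frac j (suc q) → i ≡ j
    frac-injective {i} {j} e = ℕP.*-cancelʳ-≡ i j (suc q) (≡⇒≈ₓ (pos {i} {q}) (pos {j} {q}) e)

farey-unique : ∀ Q → Unique (farey Q)
farey-unique Q = UniqueP.concat⁺
  (AllP.map⁺ (All.tabulate (λ {q} _ → ofHeight-unique q)))
  (AllPairsP.map⁺ (AllPairs.map disjoint (UniqueP.upTo⁺ Q)))
  where
    disjoint : ∀ {p q} → p ≢ q → ∀ {β} → ¬ (β ∈ ofHeight (suc p) × β ∈ ofHeight (suc q))
    disjoint p≢q (m₁ , m₂) =
      p≢q (ℕP.suc-injective (trans (sym (∈-ofHeight⇒height m₁)) (∈-ofHeight⇒height m₂)))

-- Stern–Brocot parents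

refuel : ∀ {h f s s′} → h < suc f + s → s < s′ → h < f + s′
refuel {h} {f} {s} h< s<s′ =
  ℕP.<-≤-trans h< (ℕP.≤-trans (ℕP.≤-reflexive (sym (ℕP.+-suc f s))) (ℕP.+-monoʳ-≤ f s<s′))

record Parents (β : ℚ) : Set where
  constructor parents
  field
    left right : Pair
    Pos-left   : Pos left
    Pos-right  : Pos right
    left⋖right : left ⋖ right
    pairOf≡    : pairOf β ≡ left ⊕ right
    right≤1    : nm right ≤ dn right

-- Stern–Brocot search below 1; the fuel is justified by ⋖-height-bound, since each
-- step increases the sum of the denominators of the bracketing pair.
sternBrocot : ∀ {β} f {L R} → Pos L → Pos R → L ⋖ R → nm L ≤ dn L → nm R ≤ dn R →
  ⟦ L ⟧ ℚ.< β → β ℚ.< ⟦ R ⟧ → height β < f + (dn L + dn R) → Parents β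
sternBrocot zero pL pR d _ _ L<β β<R h< =
  ⊥-elim (ℕP.<-irrefl refl (ℕP.<-≤-trans h< (⋖-height-bound pL pR d L<β β<R)))
sternBrocot {β} (suc f) {L} {R} pL pR d L≤1 R≤1 L<β β<R h< with ℚP.<-cmp β ⟦ L ⊕ R ⟧
... | tri≈ _ β≡M _ = parents L R pL pR d (trans (cong pairOf β≡M) (pairOf-mediant pL pR d)) R≤1
... | tri< β<M _ _ = sternBrocot f pL (Pos-⊕ R pL) (⋖-⊕ˡ d) L≤1 (ℕP.+-mono-≤ L≤1 R≤1) L<β β<M
  (refuel {f = f} h< (ℕP.m<n+m _ (Pos⇒≥1 pL)))
... | tri> _ _ M<β = sternBrocot f (Pos-⊕ R pL) pR (⋖-⊕ʳ d) (ℕP.+-mono-≤ L≤1 R≤1) R≤1 M<β β<R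
  (refuel {f = f} h< (ℕP.m<m+n _ (Pos⇒≥1 pR)))

sternBrocot-parents : ∀ β → 0ℚ ℚ.< β → β ℚ.< 1ℚ → Parents β
sternBrocot-parents β 0<β β<1 = sternBrocot (suc (height β)) (pos {0} {0}) (pos {1} {0}) (mk⋖ refl)
  z≤n (s≤s z≤n) 0<β β<1 (ℕP.m≤m+n (suc (height β)) 2)

T-does : ∀ {A : Set} (d : Dec A) → T (does d) ⇔ A
T-does (yes a) = mk⇔ (const a) (const tt)
T-does (no ¬a) = mk⇔ (λ ()) ¬a

T-allB : ∀ (p : ℚ → Bool) xs → T (allB p xs) ⇔ (∀ {x} → x ∈ xs → T (p x))
T-allB p [] = mk⇔ (λ _ ()) (const tt)
T-allB p (x ∷ xs) = mk⇔
  (λ t → let (px , pxs) = to T-∧ t in λ { (here refl) → px ; (there m) → to (T-allB p xs) pxs m })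
  (λ h → from T-∧ (h (here refl) , from (T-allB p xs) (λ m → h (there m))))

T-isLess : ∀ c → T (isLess c) ⇔ c ≡ less
T-isLess less    = mk⇔ (const refl) (const tt)
T-isLess equal   = mk⇔ (λ ()) (λ ())
T-isLess greater = mk⇔ (λ ()) (λ ())

T-isGreater : ∀ c → T (isGreater c) ⇔ c ≡ greater
T-isGreater less    = mk⇔ (λ ()) (λ ())
T-isGreater equal   = mk⇔ (λ ()) (λ ())
T-isGreater greater = mk⇔ (const refl) (const tt)

does≡true⇒ : ∀ {A : Set} (d : Dec A) → does d ≡ true → A
does≡true⇒ (yes a) _ = a

does≡false⇒¬ : ∀ {A : Set} (d : Dec A) → does d ≡ false → ¬ A
does≡false⇒¬ (no ¬a) _ = ¬a

<ᵇ-accept : ∀ {r s} → r ℚ.< s → r <ᵇ s ≡ true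
<ᵇ-accept {r} {s} = dec-true (r ℚP.<? s)

<ᵇ-reject : ∀ {r s} → ¬ r ℚ.< s → r <ᵇ s ≡ false
<ᵇ-reject {r} {s} = dec-false (r ℚP.<? s)

ratPt-less : ∀ δ r → ratPt δ r ≡ less ⇔ r ℚ.< δ
ratPt-less δ r with r <ᵇ δ in e | r == δ
... | true  | _     = mk⇔ (const (does≡true⇒ (r ℚP.<? δ) e)) (const refl)
... | false | true  = mk⇔ (λ ()) (⊥-elim ∘ does≡false⇒¬ (r ℚP.<? δ) e)
... | false | false = mk⇔ (λ ()) (⊥-elim ∘ does≡false⇒¬ (r ℚP.<? δ) e)

ratPt-greater : ∀ δ r → ratPt δ r ≡ greater ⇔ δ ℚ.< r
ratPt-greater δ r with r <ᵇ δ in e | r == δ in e′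
... | true  | _     = mk⇔ (λ ()) (λ δ<r → ⊥-elim (ℚP.<-asym (does≡true⇒ (r ℚP.<? δ) e) δ<r))
... | false | true  = mk⇔ (λ ()) (λ δ<r → ⊥-elim (ℚP.<-irrefl (sym (does≡true⇒ (r ℚP.≟ δ) e′)) δ<r))
... | false | false = mk⇔
  (const (≮∧≢⇒> (does≡false⇒¬ (r ℚP.<? δ) e) (does≡false⇒¬ (r ℚP.≟ δ) e′))) (const refl)

T-inArc-< : ∀ {a b} (x : Point) → a ℚ.< b → T (inArc a b x) ⇔ (x a ≡ less × x b ≡ greater)
T-inArc-< {a} {b} x a<b rewrite <ᵇ-accept a<b = ⇔.trans T-∧ (T-isLess (x a) ×-⇔ T-isGreater (x b))

T-inArc-≮ : ∀ {a b} (x : Point) → ¬ a ℚ.< b → T (inArc a b x) ⇔ (x a ≡ less ⊎ x b ≡ greater)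
T-inArc-≮ {a} {b} x a≮b rewrite <ᵇ-reject a≮b = ⇔.trans T-∨ (T-isLess (x a) ⊎-⇔ T-isGreater (x b))

-- Arcs of ℝ/ℤ and Farey neighbours

_∈I⟨_,_⟩ : ℚ → ℚ → ℚ → Set
δ ∈I⟨ a , b ⟩ = (a ℚ.< b × a ℚ.< δ × δ ℚ.< b) ⊎ (¬ a ℚ.< b × (a ℚ.< δ ⊎ δ ℚ.< b))

T-inArc-ratPt : ∀ a b δ → T (inArc a b (ratPt δ)) ⇔ δ ∈I⟨ a , b ⟩
T-inArc-ratPt a b δ with a ℚP.<? b
... | yes a<b = mk⇔ (λ t → inj₁ (a<b , to decode t))
                    [ (λ (_ , p) → from decode p) , (λ (a≮b , _) → ⊥-elim (a≮b a<b)) ]′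
  where decode = ⇔.trans (T-inArc-< (ratPt δ) a<b) (ratPt-less δ a ×-⇔ ratPt-greater δ b)
... | no a≮b = mk⇔ (λ t → inj₂ (a≮b , to decode t))
                   [ (λ (a<b , _) → ⊥-elim (a≮b a<b)) , (λ (_ , p) → from decode p) ]′
  where decode = ⇔.trans (T-inArc-≮ (ratPt δ) a≮b) (ratPt-less δ a ⊎-⇔ ratPt-greater δ b)

∈I-trichotomy : ∀ {a b c} → a ≢ b → a ≢ c → b ≢ c → b ∈I⟨ a , c ⟩ ⊎ c ∈I⟨ a , b ⟩
∈I-trichotomy {a} {b} {c} a≢b a≢c b≢c with ℚP.<-cmp a c | ℚP.<-cmp a b
... | tri≈ _ a≡c _ | _            = ⊥-elim (a≢c a≡c)
... | _            | tri≈ _ a≡b _ = ⊥-elim (a≢b a≡b)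
... | tri< a<c _ _ | tri> a≮b _ _ = inj₂ (inj₂ (a≮b , inj₁ a<c))
... | tri> a≮c _ _ | tri< a<b _ _ = inj₁ (inj₂ (a≮c , inj₁ a<b))
... | tri< a<c _ _ | tri< a<b _ _ with ℚP.<-cmp b c
...   | tri< b<c _ _ = inj₁ (inj₁ (a<c , a<b , b<c))
...   | tri≈ _ b≡c _ = ⊥-elim (b≢c b≡c)
...   | tri> _ _ c<b = inj₂ (inj₁ (a<b , a<c , c<b))
∈I-trichotomy a≢b a≢c b≢c | tri> a≮c _ _ | tri> a≮b _ _ with ℚP.<-cmp _ _
...   | tri< b<c _ _ = inj₁ (inj₂ (a≮c , inj₂ b<c))
...   | tri≈ _ b≡c _ = ⊥-elim (b≢c b≡c)
...   | tri> _ _ c<b = inj₂ (inj₂ (a≮b , inj₂ c<b))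

∈I-rotate : ∀ {a b c} → a ≢ c → b ∈I⟨ a , c ⟩ → c ∈I⟨ b , a ⟩
∈I-rotate _ (inj₁ (_ , a<b , b<c)) = inj₂ (ℚP.<-asym a<b , inj₁ b<c)
∈I-rotate a≢c (inj₂ (a≮c , inj₁ a<b)) = inj₂ (ℚP.<-asym a<b , inj₂ (≮∧≢⇒> a≮c a≢c))
∈I-rotate a≢c (inj₂ (a≮c , inj₂ b<c)) = inj₁ (ℚP.<-trans b<c c<a , b<c , c<a)
  where c<a = ≮∧≢⇒> a≮c a≢c

T-not-⇔ : ∀ {b} {A : Set} → T b ⇔ A → T (not b) ⇔ (¬ A)
T-not-⇔ {true}  e = mk⇔ (λ ()) (λ ¬a → ⊥-elim (¬a (to e tt)))
T-not-⇔ {false} e = mk⇔ (λ _ a → from e a) (const tt)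

T-nbrTest : ∀ F β γ a b →
  T (not (γ == β) ∧ allB (λ δ → not (inArc a b (ratPt δ))) F) ⇔
  (γ ≢ β × (∀ {δ} → δ ∈ F → ¬ δ ∈I⟨ a , b ⟩))
T-nbrTest F β γ a b = ⇔.trans T-∧ (T-not-⇔ (T-does (γ ℚP.≟ β)) ×-⇔ ⇔.trans (T-allB _ F)
  (mk⇔ (λ h {δ} m → to (T-not-⇔ (T-inArc-ratPt a b δ)) (h m))
       (λ h {δ} m → from (T-not-⇔ (T-inArc-ratPt a b δ)) (h m))))

head0-filter : ∀ (p : ℚ → Bool) xs {c} → c ∈ xs → T (p c) → (∀ {γ} → γ ∈ xs → T (p γ) → γ ≡ c) →
  head0 (filter (λ γ → T? (p γ)) xs) ≡ c
head0-filter p (x ∷ xs) c∈ pc unique with p x in e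
... | true = unique (here refl) (subst T (sym e) tt)
... | false with c∈
...   | here refl  = ⊥-elim (subst T e pc)
...   | there c∈xs = head0-filter p xs c∈xs pc (unique ∘ there)

record IsLeftNbr (F : List ℚ) (β γ : ℚ) : Set where
  field
    member   : γ ∈ F
    distinct : γ ≢ β
    empty    : ∀ {δ} → δ ∈ F → ¬ δ ∈I⟨ γ , β ⟩

record IsRightNbr (F : List ℚ) (β γ : ℚ) : Set where
  field
    member   : γ ∈ F
    distinct : γ ≢ β
    empty    : ∀ {δ} → δ ∈ F → ¬ δ ∈I⟨ β , γ ⟩

module Left = IsLeftNbr
module Right = IsRightNbr

IsLeftNbr-unique : ∀ {F β γ γ′} → IsLeftNbr F β γ → IsLeftNbr F β γ′ → γ′ ≡ γ
IsLeftNbr-unique {γ = γ} {γ′} l l′ with γ′ ℚP.≟ γ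
... | yes γ′≡γ = γ′≡γ
... | no γ′≢γ with ∈I-trichotomy (Left.distinct l′ ∘ sym) (Left.distinct l ∘ sym) γ′≢γ
...   | inj₁ γ′∈ = ⊥-elim (Left.empty l′ (Left.member l) (∈I-rotate (Left.distinct l ∘ sym) γ′∈))
...   | inj₂ γ∈  = ⊥-elim (Left.empty l (Left.member l′) (∈I-rotate (Left.distinct l′ ∘ sym) γ∈))

IsRightNbr-unique : ∀ {F β γ γ′} → IsRightNbr F β γ → IsRightNbr F β γ′ → γ′ ≡ γ
IsRightNbr-unique {γ = γ} {γ′} r r′ with γ′ ℚP.≟ γ
... | yes γ′≡γ = γ′≡γ
... | no γ′≢γ with ∈I-trichotomy (Right.distinct r′ ∘ sym) (Right.distinct r ∘ sym) γ′≢γ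
...   | inj₁ γ′∈ = ⊥-elim (Right.empty r (Right.member r′) γ′∈)
...   | inj₂ γ∈  = ⊥-elim (Right.empty r′ (Right.member r) γ∈)

leftNbr≡ : ∀ {β γ} → IsLeftNbr (farey (height β)) β γ → leftNbr β ≡ γ
leftNbr≡ {β} {γ} l = head0-filter _ (farey (height β)) (Left.member l)
  (from (T-nbrTest _ β γ γ β) (Left.distinct l , Left.empty l))
  (λ m t → let (≢β , e) = to (T-nbrTest _ β _ _ β) t in
    IsLeftNbr-unique l record { member = m ; distinct = ≢β ; empty = e })

rightNbr≡ : ∀ {β γ} → IsRightNbr (farey (height β)) β γ → rightNbr β ≡ γ
rightNbr≡ {β} {γ} r = head0-filter _ (farey (height β)) (Right.member r)
  (from (T-nbrTest _ β γ β γ) (Right.distinct r , Right.empty r))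
  (λ m t → let (≢β , e) = to (T-nbrTest _ β _ β _) t in
    IsRightNbr-unique r record { member = m ; distinct = ≢β ; empty = e })

⋖-gapˡ : ∀ {X Y δ} → Pos X → Pos Y → X ⋖ Y →
  ⟦ X ⟧ ℚ.< δ → δ ℚ.< ⟦ X ⊕ Y ⟧ → dn (X ⊕ Y) < height δ
⋖-gapˡ {X} {Y} pX pY d X<δ δ<M = ℕP.<-≤-trans (ℕP.m<n+m (dn (X ⊕ Y)) (Pos⇒≥1 pX))
  (⋖-height-bound pX (Pos-⊕ Y pX) (⋖-⊕ˡ d) X<δ δ<M)

⋖-gapʳ : ∀ {X Y δ} → Pos X → Pos Y → X ⋖ Y →
  ⟦ X ⊕ Y ⟧ ℚ.< δ → δ ℚ.< ⟦ Y ⟧ → dn (X ⊕ Y) < height δ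
⋖-gapʳ {X} {Y} pX pY d M<δ δ<Y = ℕP.<-≤-trans (ℕP.m<m+n (dn (X ⊕ Y)) (Pos⇒≥1 pY))
  (⋖-height-bound (Pos-⊕ Y pX) pY (⋖-⊕ʳ d) M<δ δ<Y)

module FareyNeighbours {β : ℚ} (qz : IsQZ β) (β≢0 : β ≢ 0ℚ) (par : Parents β) where

  open Parents par renaming (left to ℓ; right to u; Pos-left to pℓ; Pos-right to pu; left⋖right to ℓ⋖u)

  F : List ℚ
  F = farey (height β)

  ⟦ℓ⊕u⟧≡β : ⟦ ℓ ⊕ u ⟧ ≡ β
  ⟦ℓ⊕u⟧≡β = trans (cong ⟦_⟧ (sym pairOf≡)) (⟦pairOf⟧ β (proj₁ qz))

  height≡ : height β ≡ dn (ℓ ⊕ u)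
  height≡ = cong dn pairOf≡

  ℓ<β : ⟦ ℓ ⟧ ℚ.< β
  ℓ<β = subst (⟦ ℓ ⟧ ℚ.<_) ⟦ℓ⊕u⟧≡β (proj₁ (⋖-mediant-between pℓ pu ℓ⋖u))

  β<u : β ℚ.< ⟦ u ⟧
  β<u = subst (ℚ._< ⟦ u ⟧) ⟦ℓ⊕u⟧≡β (proj₂ (⋖-mediant-between pℓ pu ℓ⋖u))

  0<β : 0ℚ ℚ.< β
  0<β = ℚP.≤-<-trans (⟦⟧-nonneg pℓ) ℓ<β

  gapˡ : ∀ {δ} → ⟦ ℓ ⟧ ℚ.< δ → δ ℚ.< β → height β < height δ
  gapˡ {δ} ℓ<δ δ<β = subst (_< height δ) (sym height≡)
    (⋖-gapˡ pℓ pu ℓ⋖u ℓ<δ (subst (_ ℚ.<_) (sym ⟦ℓ⊕u⟧≡β) δ<β))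

  gapʳ : ∀ {δ} → β ℚ.< δ → δ ℚ.< ⟦ u ⟧ → height β < height δ
  gapʳ {δ} β<δ δ<u = subst (_< height δ) (sym height≡)
    (⋖-gapʳ pℓ pu ℓ⋖u (subst (ℚ._< _) (sym ⟦ℓ⊕u⟧≡β) β<δ) δ<u)

  height≤ : ∀ {δ} → δ ∈ F → height δ ≤ height β
  height≤ m = proj₂ (farey-sound m)

  ⟦⟧∈F : ∀ {X} → Pos X → ⟦ X ⟧ ℚ.< 1ℚ → dn X ≤ height β → ⟦ X ⟧ ∈ F
  ⟦⟧∈F pX X<1 dn≤ = farey-complete (⟦⟧-nonneg pX , X<1) (ℕP.≤-trans (height-⟦⟧ pX) dn≤)

  dnℓ≤height : dn ℓ ≤ height β
  dnℓ≤height = subst (dn ℓ ≤_) (sym height≡) (ℕP.m≤m+n (dn ℓ) (dn u))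

  dnu≤height : dn u ≤ height β
  dnu≤height = subst (dn u ≤_) (sym height≡) (ℕP.m≤n+m (dn u) (dn ℓ))

  ℓ-isLeftNbr : IsLeftNbr F β ⟦ ℓ ⟧
  ℓ-isLeftNbr = record
    { member   = ⟦⟧∈F pℓ (ℚP.<-trans ℓ<β (proj₂ qz)) dnℓ≤height
    ; distinct = ℚP.<⇒≢ ℓ<β
    ; empty    = λ where
        m (inj₁ (_ , ℓ<δ , δ<β)) → ℕP.<⇒≱ (gapˡ ℓ<δ δ<β) (height≤ m)
        _ (inj₂ (ℓ≮β , _))       → ℓ≮β ℓ<β
    }

  u-isRightNbr : ⟦ u ⟧ ℚ.< 1ℚ → IsRightNbr F β ⟦ u ⟧
  u-isRightNbr u<1 = record
    { member   = ⟦⟧∈F pu u<1 dnu≤height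
    ; distinct = ℚP.<⇒≢ β<u ∘ sym
    ; empty    = λ where
        m (inj₁ (_ , β<δ , δ<u)) → ℕP.<⇒≱ (gapʳ β<δ δ<u) (height≤ m)
        _ (inj₂ (β≮u , _))       → β≮u β<u
    }

  -- When u = 1 the right neighbour wraps around to 0.
  0-isRightNbr : ⟦ u ⟧ ≡ 1ℚ → IsRightNbr F β 0ℚ
  0-isRightNbr u≡1 = record
    { member   = farey-complete {height β} (ℚP.≤-refl , 0<1) (s≤s z≤n)
    ; distinct = β≢0 ∘ sym
    ; empty    = λ where
        _ (inj₁ (β<0 , _))          → ℚP.<-asym β<0 0<β
        m (inj₂ (_ , inj₁ β<δ))     →
          ℕP.<⇒≱ (gapʳ β<δ (subst (_ ℚ.<_) (sym u≡1) (proj₂ (proj₁ (farey-sound {height β} m))))) (height≤ m)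
        m (inj₂ (_ , inj₂ δ<0))     → <⇒≱ δ<0 (proj₁ (proj₁ (farey-sound {height β} m)))
    }

  leftNbr≡ℓ : leftNbr β ≡ ⟦ ℓ ⟧
  leftNbr≡ℓ = leftNbr≡ ℓ-isLeftNbr

  rightNbr-cases : (rightNbr β ≡ ⟦ u ⟧ × ⟦ u ⟧ ℚ.< 1ℚ) ⊎ (rightNbr β ≡ 0ℚ × ⟦ u ⟧ ≡ 1ℚ)
  rightNbr-cases with ℕP.m≤n⇒m<n∨m≡n right≤1
  ... | inj₁ u<1 = inj₁ (rightNbr≡ (u-isRightNbr (nm<dn⇒<1 pu u<1)) , nm<dn⇒<1 pu u<1)
  ... | inj₂ u≡1 = inj₂ (rightNbr≡ (0-isRightNbr (nm≡dn⇒≡1 pu u≡1)) , nm≡dn⇒≡1 pu u≡1)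

-- Sums

sumℚ-++ : ∀ xs ys → sumℚ (xs ++ ys) ≡ sumℚ xs ℚ.+ sumℚ ys
sumℚ-++ []       ys = sym (ℚP.+-identityˡ (sumℚ ys))
sumℚ-++ (x ∷ xs) ys = trans (cong (x ℚ.+_) (sumℚ-++ xs ys)) (sym (ℚP.+-assoc x (sumℚ xs) (sumℚ ys)))

sumℚ-concatMap : ∀ (f : ℚ → ℚ) (g : ℕ → List ℚ) xs →
  sumℚ (map f (concatMap g xs)) ≡ sumℚ (map (λ q → sumℚ (map f (g q))) xs)
sumℚ-concatMap f g []       = refl
sumℚ-concatMap f g (x ∷ xs) = begin
  sumℚ (map f (g x ++ concatMap g xs))
    ≡⟨ cong sumℚ (ListP.map-++ f (g x) (concatMap g xs)) ⟩
  sumℚ (map f (g x) ++ map f (concatMap g xs))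
    ≡⟨ sumℚ-++ (map f (g x)) _ ⟩
  sumℚ (map f (g x)) ℚ.+ sumℚ (map f (concatMap g xs))
    ≡⟨ cong (sumℚ (map f (g x)) ℚ.+_) (sumℚ-concatMap f g xs) ⟩
  sumℚ (map f (g x)) ℚ.+ sumℚ (map (λ q → sumℚ (map f (g q))) xs) ∎
  where open ≡-Reasoning

ℕ/1-homo-+ : ∀ m n → (+ m) / 1 ℚ.+ (+ n) / 1 ≡ (+ (m + n)) / 1
ℕ/1-homo-+ m n = ℚP.toℚᵘ-injective (ℚᵘP.≃-trans (ℚP.toℚᵘ-homo-+ ((+ m) / 1) ((+ n) / 1))
  (ℚᵘP.≃-trans (ℚᵘP.+-cong (ℚP.toℚᵘ-fromℚᵘ (mkℚᵘ (+ m) 0)) (ℚP.toℚᵘ-fromℚᵘ (mkℚᵘ (+ n) 0)))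
  (ℚᵘP.≃-trans (ℚᵘ.*≡* sum≡) (ℚᵘP.≃-sym (ℚP.toℚᵘ-fromℚᵘ (mkℚᵘ (+ (m + n)) 0))))))
  where
    sum≡ : (+ m ℤ.* + 1 ℤ.+ + n ℤ.* + 1) ℤ.* + 1 ≡ + (m + n) ℤ.* + (1 * 1)
    sum≡ = trans (ℤP.*-identityʳ _) (trans (cong₂ ℤ._+_ (ℤP.*-identityʳ (+ m)) (ℤP.*-identityʳ (+ n)))
             (trans (sym (ℤP.pos-+ m n)) (sym (ℤP.*-identityʳ (+ (m + n))))))

-- Stated over variables so that checking sum-01≡count never normalises a rational.
+0-step : ∀ a s k l → a ≡ 0ℚ → s ≡ (+ k) / 1 → l ≡ k → a ℚ.+ s ≡ (+ l) / 1
+0-step _ _ k _ refl refl refl = ℚP.+-identityˡ ((+ k) / 1)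

+1-step : ∀ a s k l → a ≡ 1ℚ → s ≡ (+ k) / 1 → l ≡ suc k → a ℚ.+ s ≡ (+ l) / 1
+1-step _ _ k _ refl refl refl = ℕ/1-homo-+ 1 k

sum-01≡count : ∀ (f : ℚ → ℚ) → (∀ x → f x ≡ 0ℚ ⊎ f x ≡ 1ℚ) → ∀ xs →
  sumℚ (map f xs) ≡ (+ length (filter (λ x → f x ℚP.≟ 1ℚ) xs)) / 1
sum-01≡count f f01 [] = refl
sum-01≡count f f01 (x ∷ xs) =
  [ (λ fx≡0 → +0-step (f x) (sumℚ (map f xs)) (count xs) (count (x ∷ xs)) fx≡0 ih
                (cong length (ListP.filter-reject f≟1 (λ fx≡1 → 0≢1 (trans (sym fx≡0) fx≡1)))))
  , (λ fx≡1 → +1-step (f x) (sumℚ (map f xs)) (count xs) (count (x ∷ xs)) fx≡1 ih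
                (cong length (ListP.filter-accept f≟1 fx≡1)))
  ]′ (f01 x)
  where
    f≟1 : ∀ x → Dec (f x ≡ 1ℚ)
    f≟1 x = f x ℚP.≟ 1ℚ
    count : List ℚ → ℕ
    count ys = length (filter f≟1 ys)
    ih : sumℚ (map f xs) ≡ (+ count xs) / 1
    ih = sum-01≡count f f01 xs
    0≢1 : 0ℚ ≢ 1ℚ
    0≢1 ()

-- The irrational point α

module Irrational (α : Point) (irr : IrrationalPoint α) where

  open IrrationalPoint irr

  less≢greater : less ≢ greater
  less≢greater ()

  less-or-greater : ∀ r → α r ≡ less ⊎ α r ≡ greater
  less-or-greater r with α r | never-equal r
  ... | less    | _   = inj₁ refl
  ... | equal   | α≢= = ⊥-elim (α≢= refl)
  ... | greater | _   = inj₂ refl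

  less-greater⇒< : ∀ {x y} → α x ≡ less → α y ≡ greater → x ℚ.< y
  less-greater⇒< {x} {y} αx αy = ℚP.≰⇒> (λ y≤x → less≢greater (trans (sym αx) (upper-closed y x y≤x αy)))

  Brackets : ℚ → ℚ → Set
  Brackets x y = (α x ≡ less × α y ≡ greater) ⊎ (α y ≡ less × α x ≡ greater)

  Brackets-widen : ∀ {c z y} → Brackets c z → Between c z y → Brackets c y
  Brackets-widen (inj₁ (αc , αz)) (inj₁ (_ , z<y)) = inj₁ (αc , upper-closed _ _ (ℚP.<⇒≤ z<y) αz)
  Brackets-widen (inj₁ (αc , αz)) (inj₂ (_ , z<c)) = ⊥-elim (ℚP.<-asym z<c (less-greater⇒< αc αz))
  Brackets-widen (inj₂ (αz , αc)) (inj₁ (c<z , _)) = ⊥-elim (ℚP.<-asym c<z (less-greater⇒< αz αc))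
  Brackets-widen (inj₂ (αz , αc)) (inj₂ (y<z , _)) = inj₂ (lower-closed _ _ (ℚP.<⇒≤ y<z) αz , αc)

  isEqual-α : ∀ r → isEqual (α r) ≡ false
  isEqual-α r with less-or-greater r
  ... | inj₁ αr rewrite αr = refl
  ... | inj₂ αr rewrite αr = refl

  χ-0or1 : ∀ β → χ β α ≡ 0ℚ ⊎ χ β α ≡ 1ℚ
  χ-0or1 β = select-0or1 (β == 0ℚ) (inArc (leftNbr β) (rightNbr β) α)
    (cong₂ _∨_ (isEqual-α (leftNbr β)) (isEqual-α (rightNbr β)))
    where
      select-0or1 : ∀ b c {e} → e ≡ false →
        (if b then 1ℚ else if c then 1ℚ else if e then ½ else 0ℚ) ≡ 0ℚ ⊎
        (if b then 1ℚ else if c then 1ℚ else if e then ½ else 0ℚ) ≡ 1ℚ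
      select-0or1 true  _     _    = inj₂ refl
      select-0or1 false true  _    = inj₂ refl
      select-0or1 false false refl = inj₁ refl

  χ≡1⇔inArc : ∀ {β} → β ≢ 0ℚ → χ β α ≡ 1ℚ ⇔ T (inArc (leftNbr β) (rightNbr β) α)
  χ≡1⇔inArc {β} β≢0 = select≡1⇔ (dec-false (β ℚP.≟ 0ℚ) β≢0) (inArc (leftNbr β) (rightNbr β) α)
    (cong₂ _∨_ (isEqual-α (leftNbr β)) (isEqual-α (rightNbr β)))
    where
      select≡1⇔ : ∀ {b} → b ≡ false → ∀ c {e} → e ≡ false →
        (if b then 1ℚ else if c then 1ℚ else if e then ½ else 0ℚ) ≡ 1ℚ ⇔ T c
      select≡1⇔ refl true  _    = mk⇔ (const tt) (const refl)
      select≡1⇔ refl false refl = mk⇔ (λ ()) (λ ())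

  Straddles : ∀ {β} → Parents β → Set
  Straddles par = α ⟦ Parents.left par ⟧ ≡ less × α ⟦ Parents.right par ⟧ ≡ greater

  χ≡1⇔Straddles : ∀ {β} → IsQZ β → β ≢ 0ℚ → (par : Parents β) → χ β α ≡ 1ℚ ⇔ Straddles par
  χ≡1⇔Straddles {β} qz β≢0 par = ⇔.trans (χ≡1⇔inArc β≢0)
    (subst (λ l → T (inArc l (rightNbr β) α) ⇔ Straddles par) (sym leftNbr≡ℓ) inArc⇔)
    where
      open FareyNeighbours qz β≢0 par
      open Parents par renaming (left to ℓ; right to u; Pos-left to pℓ)
      wrapped : ⟦ u ⟧ ≡ 1ℚ → (α ⟦ ℓ ⟧ ≡ less ⊎ α 0ℚ ≡ greater) ⇔ Straddles par
      wrapped u≡1 = mk⇔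
        [ (λ αℓ → αℓ , subst (λ z → α z ≡ greater) (sym u≡1) one-above)
        , (λ α0 → ⊥-elim (less≢greater (trans (sym zero-below) α0))) ]′
        (inj₁ ∘ proj₁)
      inArc⇔ : T (inArc ⟦ ℓ ⟧ (rightNbr β) α) ⇔ Straddles par
      inArc⇔ = [ (λ (r≡u , _) → subst (λ r → T (inArc ⟦ ℓ ⟧ r α) ⇔ Straddles par) (sym r≡u)
                     (T-inArc-< α (ℚP.<-trans ℓ<β β<u)))
               , (λ (r≡0 , u≡1) → subst (λ r → T (inArc ⟦ ℓ ⟧ r α) ⇔ Straddles par) (sym r≡0)
                     (⇔.trans (T-inArc-≮ α (λ ℓ<0 → <⇒≱ ℓ<0 (⟦⟧-nonneg pℓ))) (wrapped u≡1)))
               ]′ rightNbr-cases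

  Brackets-separates : ∀ {X M Y b} → Between X M Y → Between M b Y → Brackets X M →
    (b ℚ.< M × α M ≡ less) ⊎ (M ℚ.< b × α M ≡ greater)
  Brackets-separates (inj₁ _) (inj₁ (M<b , _)) (inj₁ (_ , αM)) = inj₂ (M<b , αM)
  Brackets-separates (inj₁ (_ , M<Y)) (inj₂ (Y<b , b<M)) (inj₁ _) =
    ⊥-elim (ℚP.<-asym M<Y (ℚP.<-trans Y<b b<M))
  Brackets-separates (inj₂ (_ , M<X)) _ (inj₁ (αX , αM)) = ⊥-elim (ℚP.<-asym M<X (less-greater⇒< αX αM))
  Brackets-separates (inj₁ (X<M , _)) _ (inj₂ (αM , αX)) = ⊥-elim (ℚP.<-asym X<M (less-greater⇒< αM αX))
  Brackets-separates (inj₂ (Y<M , _)) (inj₁ (M<b , b<Y)) (inj₂ _) =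
    ⊥-elim (ℚP.<-asym Y<M (ℚP.<-trans M<b b<Y))
  Brackets-separates (inj₂ _) (inj₂ (_ , b<M)) (inj₂ (αM , _)) = inj₁ (b<M , αM)

  mediant-parents : ∀ {β X Y} → β ≡ ⟦ X ⊕ Y ⟧ → Pos X → Pos Y → Adjacent X Y →
    nm X ≤ dn X → nm Y ≤ dn Y → Brackets ⟦ X ⟧ ⟦ Y ⟧ → Σ[ par ∈ Parents β ] Straddles par
  mediant-parents β≡ pX pY (inj₁ d) _ Y≤1 (inj₁ αXY) =
    parents _ _ pX pY d (trans (cong pairOf β≡) (pairOf-mediant pX pY d)) Y≤1 , αXY
  mediant-parents {X = X} {Y} β≡ pX pY (inj₂ d) X≤1 _ (inj₂ αYX) =
    parents _ _ pY pX d (trans (cong pairOf (trans β≡ (cong ⟦_⟧ (⊕-comm X Y)))) (pairOf-mediant pY pX d))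
      X≤1 , αYX
  mediant-parents _ pX pY (inj₁ d) _ _ (inj₂ (αY , αX)) =
    ⊥-elim (ℚP.<-asym (⋖⇒< pX pY d) (less-greater⇒< αY αX))
  mediant-parents _ pX pY (inj₂ d) _ _ (inj₁ (αX , αY)) =
    ⊥-elim (ℚP.<-asym (⋖⇒< pY pX d) (less-greater⇒< αX αY))

-- Continued fractions

Within : ℚ → ℚ → ℚ → Set
Within a x b = (a ℚ.≤ x × x ℚ.≤ b) ⊎ (b ℚ.≤ x × x ℚ.≤ a)

Within-sym : ∀ {a x b} → Within a x b → Within b x a
Within-sym (inj₁ (p , q)) = inj₂ (p , q)
Within-sym (inj₂ (p , q)) = inj₁ (p , q)

Within-left : ∀ x y → Within x x y
Within-left x y with ℚP.≤-total x y
... | inj₁ x≤y = inj₁ (ℚP.≤-refl , x≤y)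
... | inj₂ y≤x = inj₂ (y≤x , ℚP.≤-refl)

Within-right : ∀ x y → Within x y y
Within-right x y = Within-sym (Within-left y x)

Within-convex : ∀ {A B x y z} → Within A x B → Within A y B → Between x z y → Within A z B
Within-convex (inj₁ (A≤x , _)) (inj₁ (_ , y≤B)) (inj₁ (x<z , z<y)) =
  inj₁ (ℚP.<⇒≤ (ℚP.≤-<-trans A≤x x<z) , ℚP.<⇒≤ (ℚP.<-≤-trans z<y y≤B))
Within-convex (inj₁ (_ , x≤B)) (inj₁ (A≤y , _)) (inj₂ (y<z , z<x)) =
  inj₁ (ℚP.<⇒≤ (ℚP.≤-<-trans A≤y y<z) , ℚP.<⇒≤ (ℚP.<-≤-trans z<x x≤B))
Within-convex (inj₂ (B≤x , _)) (inj₂ (_ , y≤A)) (inj₁ (x<z , z<y)) =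
  inj₂ (ℚP.<⇒≤ (ℚP.≤-<-trans B≤x x<z) , ℚP.<⇒≤ (ℚP.<-≤-trans z<y y≤A))
Within-convex (inj₂ (_ , x≤A)) (inj₂ (B≤y , _)) (inj₂ (y<z , z<x)) =
  inj₂ (ℚP.<⇒≤ (ℚP.≤-<-trans B≤y y<z) , ℚP.<⇒≤ (ℚP.<-≤-trans z<x x≤A))
Within-convex (inj₁ (A≤x , _)) (inj₂ (_ , y≤A)) (inj₁ (x<z , z<y)) =
  ⊥-elim (<⇒≱ (ℚP.<-trans x<z z<y) (ℚP.≤-trans y≤A A≤x))
Within-convex (inj₁ (_ , x≤B)) (inj₂ (B≤y , _)) (inj₂ (y<z , z<x)) =
  ⊥-elim (<⇒≱ (ℚP.<-trans y<z z<x) (ℚP.≤-trans x≤B B≤y))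
Within-convex (inj₂ (B≤x , _)) (inj₁ (_ , y≤B)) (inj₁ (x<z , z<y)) =
  ⊥-elim (<⇒≱ (ℚP.<-trans x<z z<y) (ℚP.≤-trans y≤B B≤x))
Within-convex (inj₂ (_ , x≤A)) (inj₁ (A≤y , _)) (inj₂ (y<z , z<x)) =
  ⊥-elim (<⇒≱ (ℚP.<-trans y<z z<x) (ℚP.≤-trans x≤A A≤y))

Within-< : ∀ {a x b} → a ℚ.< b → Within a x b → a ℚ.≤ x × x ℚ.≤ b
Within-< _   (inj₁ a≤x≤b)       = a≤x≤b
Within-< a<b (inj₂ (b≤x , x≤a)) = ⊥-elim (<⇒≱ a<b (ℚP.≤-trans b≤x x≤a))

module ContinuedFraction (a : ℕ → ℕ) (α : Point) (irr : IrrationalPoint α) (cf : IsCFExpansion a α) where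

  open IrrationalPoint irr
  open IsCFExpansion cf
  open Irrational α irr

  -- pq n = (p_{n-2}, q_{n-2}), so ⟦ inter n m ⟧ is the element of E_n with parameter m.
  pq : ℕ → Pair
  pq n = (P a n , Qd a n)

  inter : ℕ → ℕ → Pair
  inter n m = iterMediant m (pq (suc n)) (pq n)

  Adjacent-pq : ∀ n → Adjacent (pq n) (pq (suc n))
  Adjacent-pq zero    = inj₁ (mk⋖ refl)
  Adjacent-pq (suc n) = Adjacent-iterMediant (a n) (Adjacent-sym (Adjacent-pq n))

  Adjacent-inter : ∀ n m → Adjacent (pq (suc n)) (inter n m)
  Adjacent-inter n m = Adjacent-iterMediant m (Adjacent-sym (Adjacent-pq n))

  Pos-pq : ∀ n → Pos (pq (2 + n))
  Pos-pq n = ≥1⇒Pos (q≥1 n)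
    where
      q≥1 : ∀ n → 1 ≤ Qd a (2 + n)
      q≥1 zero    = ℕP.m≤n+m 1 (a 0 * 0)
      q≥1 (suc n) = ℕP.≤-trans (ℕP.*-mono-≤ (positive n) (q≥1 n)) (ℕP.m≤m+n _ _)

  pq-between : ∀ i → Between ⟦ pq (3 + i) ⟧ ⟦ pq (4 + i) ⟧ ⟦ pq (2 + i) ⟧
  pq-between i with a (2 + i) | positive (suc i)
  ... | suc t | _ =
    subst (λ k → Between ⟦ pq (3 + i) ⟧ ⟦ iterMediant k (pq (3 + i)) (pq (2 + i)) ⟧ ⟦ pq (2 + i) ⟧)
    (ℕP.+-identityʳ (suc t))
    (iterMediant-between (Pos-pq (suc i)) (Adjacent-sym (Adjacent-pq (2 + i))) 0 (Pos-pq i) t)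

  pq-nested : ∀ i k → Within ⟦ pq (2 + i) ⟧ ⟦ pq (2 + (k + i)) ⟧ ⟦ pq (3 + i) ⟧ ×
                      Within ⟦ pq (2 + i) ⟧ ⟦ pq (3 + (k + i)) ⟧ ⟦ pq (3 + i) ⟧
  pq-nested i zero    = Within-left _ _ , Within-right _ _
  pq-nested i (suc k) with pq-nested i k
  ... | wₖ , wₖ₊₁ = wₖ₊₁ , Within-convex wₖ₊₁ wₖ (pq-between (k + i))

  Cofinally : (ℕ → Set) → Set
  Cofinally Pr = ∀ N → ∃ λ n → N ≤ n × Pr n

  private
    open +-*-Solver using (solve; _:=_; _:+_; _:-_)

    sub-sub : ∀ r s → r ℚ.- (r ℚ.- s) ≡ s
    sub-sub = solve 2 (λ r s → r :- (r :- s) := s) refl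

    add-sub : ∀ r s → r ℚ.+ (s ℚ.- r) ≡ s
    add-sub = solve 2 (λ r s → r :+ (s :- r) := s) refl

    0<-∸ : ∀ {s r} → s ℚ.< r → 0ℚ ℚ.< r ℚ.- s
    0<-∸ {s} {r} s<r = subst (ℚ._< r ℚ.- s) (ℚP.+-inverseʳ s) (ℚP.+-monoˡ-< (ℚ.- s) s<r)

  cofinally-≤⇒less : ∀ r → Cofinally (λ n → r ℚ.≤ convergent a n) → α r ≡ less
  cofinally-≤⇒less r h with less-or-greater r
  ... | inj₁ αr = αr
  ... | inj₂ αr with upper-open r αr
  ... | s , s<r , αs with converges (r ℚ.- s) (0<-∸ s<r)
  ... | N , conv≈ with h N
  ... | n , N≤n , r≤cₙ =
    ⊥-elim (less≢greater (trans (sym (proj₁ (conv≈ n N≤n))) (upper-closed s _ s≤ αs)))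
    where
      s≤ : s ℚ.≤ convergent a n ℚ.- (r ℚ.- s)
      s≤ = subst (ℚ._≤ convergent a n ℚ.- (r ℚ.- s)) (sub-sub r s) (ℚP.+-monoˡ-≤ (ℚ.- (r ℚ.- s)) r≤cₙ)

  cofinally-≥⇒greater : ∀ r → Cofinally (λ n → convergent a n ℚ.≤ r) → α r ≡ greater
  cofinally-≥⇒greater r h with less-or-greater r
  ... | inj₂ αr = αr
  ... | inj₁ αr with lower-open r αr
  ... | s , r<s , αs with converges (s ℚ.- r) (0<-∸ r<s)
  ... | N , conv≈ with h N
  ... | n , N≤n , cₙ≤r =
    ⊥-elim (less≢greater (trans (sym (lower-closed _ s ≤s αs)) (proj₂ (conv≈ n N≤n))))
    where
      ≤s : convergent a n ℚ.+ (s ℚ.- r) ℚ.≤ s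
      ≤s = subst (convergent a n ℚ.+ (s ℚ.- r) ℚ.≤_) (add-sub r s) (ℚP.+-monoˡ-≤ (s ℚ.- r) cₙ≤r)

  squeezed : ∀ {i A B} → A ℚ.< B → (∀ k → Within A ⟦ pq (2 + (k + i)) ⟧ B) → α A ≡ less × α B ≡ greater
  squeezed {i} A<B w =
    cofinally-≤⇒less _ (λ N → N + i , ℕP.m≤m+n N i , proj₁ (Within-< A<B (w N))) ,
    cofinally-≥⇒greater _ (λ N → N + i , ℕP.m≤m+n N i , proj₂ (Within-< A<B (w N)))

  α-Brackets-pq : ∀ i → Brackets ⟦ pq (2 + i) ⟧ ⟦ pq (3 + i) ⟧
  α-Brackets-pq i with Adjacent-pq (2 + i)
  ... | inj₁ d = inj₁ (squeezed (⋖⇒< (Pos-pq i) (Pos-pq (suc i)) d) (proj₁ ∘ pq-nested i))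
  ... | inj₂ d = inj₂ (squeezed (⋖⇒< (Pos-pq (suc i)) (Pos-pq i) d) (Within-sym ∘ proj₁ ∘ pq-nested i))

  α-Brackets-inter : ∀ n m → m < a (suc n) → Pos (inter (suc n) m) →
    Brackets ⟦ pq (2 + n) ⟧ ⟦ inter (suc n) m ⟧
  α-Brackets-inter n m m<a pᵢ = Brackets-widen (α-Brackets-pq n)
    (subst (λ k → Between ⟦ pq (2 + n) ⟧ ⟦ iterMediant k (pq (2 + n)) (pq (suc n)) ⟧ ⟦ inter (suc n) m ⟧) j+m≡a
      (iterMediant-between (Pos-pq n) (Adjacent-sym (Adjacent-pq (suc n))) m pᵢ j))
    where
      j = a (suc n) ∸ suc m
      j+m≡a : suc j + m ≡ a (suc n)
      j+m≡a = trans (cong suc (ℕP.+-comm j m)) (ℕP.m+[n∸m]≡n m<a)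

  α-Brackets-next : ∀ n m → suc m ≤ a (suc n) → Brackets ⟦ pq (2 + n) ⟧ ⟦ inter (suc n) (suc m) ⟧
  α-Brackets-next n m sm≤a with ℕP.m≤n⇒m<n∨m≡n sm≤a
  ... | inj₁ sm<a = α-Brackets-inter n (suc m) sm<a (Pos-iterMediant-suc m (pq (suc n)) (Pos-pq n))
  ... | inj₂ sm≡a = subst (λ k → Brackets ⟦ pq (2 + n) ⟧ ⟦ iterMediant k (pq (2 + n)) (pq (suc n)) ⟧)
    (sym sm≡a) (α-Brackets-pq n)

  P₂≡0 : P a 2 ≡ 0
  P₂≡0 rewrite a₀ = refl

  Q₂≡1 : Qd a 2 ≡ 1
  Q₂≡1 rewrite a₀ = refl

  ⟦pq₂⟧≡0 : ⟦ pq 2 ⟧ ≡ 0ℚ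
  ⟦pq₂⟧≡0 = cong₂ frac P₂≡0 Q₂≡1

  ⟦inter₁₁⟧≡1 : ⟦ inter 1 1 ⟧ ≡ 1ℚ
  ⟦inter₁₁⟧≡1 = cong₂ (λ p q → frac (1 * p + 1) (1 * q + 0)) P₂≡0 Q₂≡1

  inter₁≤1 : ∀ m → 1 ≤ m → nm (inter 1 m) ≤ dn (inter 1 m)
  inter₁≤1 m m≥1 rewrite P₂≡0 | Q₂≡1 | ℕP.*-zeroʳ m | ℕP.*-identityʳ m | ℕP.+-identityʳ m = m≥1

  pq≤1 : ∀ i → nm (pq (2 + i)) ≤ dn (pq (2 + i))
  pq≤1 zero rewrite P₂≡0 = z≤n
  pq≤1 (suc zero) = inter₁≤1 (a 1) (positive 0)
  pq≤1 (suc (suc k)) = ℕP.+-mono-≤ (ℕP.*-monoʳ-≤ (a (2 + k)) (pq≤1 (suc k))) (pq≤1 k)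

  inter≤1 : ∀ n m → Pos (inter (suc n) m) → nm (inter (suc n) m) ≤ dn (inter (suc n) m)
  inter≤1 zero m p = inter₁≤1 m
    (subst (1 ≤_) (trans (ℕP.+-identityʳ _) (trans (cong (m *_) Q₂≡1) (ℕP.*-identityʳ m))) (Pos⇒≥1 p))
  inter≤1 (suc k) m _ = ℕP.+-mono-≤ (ℕP.*-monoʳ-≤ m (pq≤1 (suc k))) (pq≤1 k)

  inter≡pq⊕ : ∀ n m → inter (suc n) (suc m) ≡ pq (2 + n) ⊕ inter (suc n) m
  inter≡pq⊕ n m = iterMediant-suc m (pq (2 + n)) (pq (suc n))

  0∈⋃E : 0ℚ ∈⋃E a
  0∈⋃E = 1 , s≤s z≤n , 1 , s≤s z≤n , positive 0 , cong modOne ⟦inter₁₁⟧≡1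

  module Descent {β : ℚ} (qz : IsQZ β) (β≢0 : β ≢ 0ℚ) (par : Parents β) (straddles : Straddles par) where

    open FareyNeighbours qz β≢0 par

    H : ℕ
    H = height β

    no-separator : ∀ {δ} → height δ ≤ H → ¬ ((β ℚ.< δ × α δ ≡ less) ⊎ (δ ℚ.< β × α δ ≡ greater))
    no-separator h (inj₁ (β<δ , αδ)) = ℕP.<⇒≱ (gapʳ β<δ (less-greater⇒< αδ (proj₂ straddles))) h
    no-separator h (inj₂ (δ<β , αδ)) = ℕP.<⇒≱ (gapˡ (less-greater⇒< (proj₁ straddles) αδ) δ<β) h

    narrow : ∀ {X Y M} → M ≡ X ⊕ Y → Pos X → Pos Y → Adjacent X Y → Between ⟦ X ⟧ β ⟦ Y ⟧ →
      Brackets ⟦ X ⟧ ⟦ M ⟧ → β ≡ ⟦ M ⟧ ⊎ Between ⟦ X ⟧ β ⟦ M ⟧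
    narrow {X} {Y} refl pX pY adj X<β<Y αXM with β ℚP.≟ ⟦ X ⊕ Y ⟧
    ... | yes β≡M = inj₁ β≡M
    ... | no β≢M = [ inj₂ , (λ M<β<Y → ⊥-elim (no-separator height≤H (Brackets-separates M∈XY M<β<Y αXM))) ]′
                   (Between-split X<β<Y M∈XY β≢M)
      where
        M∈XY = mediant-between pX pY adj
        height≤H : height ⟦ X ⊕ Y ⟧ ≤ H
        height≤H = ℕP.≤-trans (height-⟦⟧ (Pos-⊕ Y pX)) (Adjacent-height-bound pX pY adj X<β<Y)

    refuel-inter : ∀ {f} n m → H < suc f + (dn (pq (2 + n)) + dn (inter (suc n) m)) →
      H < f + (dn (pq (2 + n)) + dn (inter (suc n) (suc m)))
    refuel-inter {f} n m h< = refuel {f = f} h< (ℕP.+-monoʳ-< (dn (pq (2 + n)))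
      (subst (dn (inter (suc n) m) <_) (sym (cong dn (inter≡pq⊕ n m)))
        (ℕP.m<n+m (dn (inter (suc n) m)) (Pos⇒≥1 (Pos-pq n)))))

    -- The interval between pq (2+n) and inter (1+n) m contains both β and α, and its
    -- mediant is the next intermediate fraction inter (1+n) (1+m).
    descend : ∀ f n m → m < a (suc n) → Pos (inter (suc n) m) →
      Between ⟦ pq (2 + n) ⟧ β ⟦ inter (suc n) m ⟧ →
      H < f + (dn (pq (2 + n)) + dn (inter (suc n) m)) → β ∈⋃E a
    descend zero n m _ pY X<β<Y h< =
      ⊥-elim (ℕP.<⇒≱ h< (Adjacent-height-bound (Pos-pq n) pY (Adjacent-inter (suc n) m) X<β<Y))
    descend (suc f) n m m<a pY X<β<Y h<
      with narrow (inter≡pq⊕ n m) (Pos-pq n) pY (Adjacent-inter (suc n) m) X<β<Y (α-Brackets-next n m m<a)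
    ... | inj₁ β≡M = suc n , s≤s z≤n , suc m , s≤s z≤n , m<a , trans (cong modOne (sym β≡M)) (modOne-id qz)
    ... | inj₂ X<β<M with ℕP.m≤n⇒m<n∨m≡n m<a
    ...   | inj₁ sm<a = descend f n (suc m) sm<a (Pos-iterMediant-suc m (pq (suc n)) (Pos-pq n)) X<β<M
                          (refuel-inter {f} n m h<)
    ...   | inj₂ sm≡a = descend f (suc n) 0 (positive (suc n)) (Pos-pq n)
      (subst (λ k → Between ⟦ iterMediant k (pq (2 + n)) (pq (suc n)) ⟧ β ⟦ pq (2 + n) ⟧) sm≡a
        (Between-sym X<β<M))
      (subst (λ k → H < f + (dn (iterMediant k (pq (2 + n)) (pq (suc n))) + dn (pq (2 + n)))) sm≡a
        (subst (λ t → H < f + t) (ℕP.+-comm (dn (pq (2 + n))) (dn (inter (suc n) (suc m))))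
          (refuel-inter {f} n m h<)))

    ∈⋃E : β ∈⋃E a
    ∈⋃E with ℕP.m≤n⇒m<n∨m≡n (positive 0)
    ... | inj₁ 1<a₁ = descend (suc H) 0 1 1<a₁ (Pos-iterMediant-suc 0 (pq 1) (Pos-pq 0))
      (inj₁ (subst (ℚ._< β) (sym ⟦pq₂⟧≡0) 0<β , subst (β ℚ.<_) (sym ⟦inter₁₁⟧≡1) (proj₂ qz)))
      (ℕP.m≤m+n (suc H) _)
    ... | inj₂ 1≡a₁ = descend (suc H) 1 0 (positive 1) (Pos-pq 0)
      (inj₂ (subst (ℚ._< β) (sym ⟦pq₂⟧≡0) 0<β ,
             subst (λ k → β ℚ.< ⟦ iterMediant k (pq 2) (pq 1) ⟧) 1≡a₁
               (subst (β ℚ.<_) (sym ⟦inter₁₁⟧≡1) (proj₂ qz))))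
      (ℕP.m≤m+n (suc H) _)

  modOne-inter⇒χ≡1 : ∀ {β} → IsQZ β → β ≢ 0ℚ → ∀ n m → suc m ≤ a (suc n) →
    modOne ⟦ inter (suc n) (suc m) ⟧ ≡ β → χ β α ≡ 1ℚ
  modOne-inter⇒χ≡1 {β} qz β≢0 n m sm≤a e = from (χ≡1⇔Straddles qz β≢0 (proj₁ par)) (proj₂ par)
    where
      M = inter (suc n) (suc m)
      pM = Pos-iterMediant-suc m (pq (suc n)) (Pos-pq n)

      Pos-inter : ∀ n m → modOne ⟦ inter (suc n) (suc m) ⟧ ≡ β → Pos (inter (suc n) m)
      Pos-inter (suc k) m _    = Pos-iterMediant m (pq (3 + k)) (Pos-pq k)
      Pos-inter zero (suc j) _ = Pos-iterMediant-suc j (pq 1) (Pos-pq 0)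
      Pos-inter zero zero e    = ⊥-elim (β≢0 (trans (sym e) (cong modOne ⟦inter₁₁⟧≡1)))

      pY = Pos-inter n m e

      M<1 : nm M < dn M
      M<1 with ℕP.m≤n⇒m<n∨m≡n (inter≤1 n (suc m) pM)
      ... | inj₁ lt = lt
      ... | inj₂ eq = ⊥-elim (β≢0 (trans (sym e) (cong modOne (nm≡dn⇒≡1 pM eq))))

      β≡ : β ≡ ⟦ pq (2 + n) ⊕ inter (suc n) m ⟧
      β≡ = trans (sym e) (trans (modOne-id (⟦⟧-nonneg pM , nm<dn⇒<1 pM M<1)) (cong ⟦_⟧ (inter≡pq⊕ n m)))

      par = mediant-parents β≡ (Pos-pq n) pY (Adjacent-inter (suc n) m) (pq≤1 n) (inter≤1 n m pY)
              (α-Brackets-inter n m sm≤a pY)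

  χ≡1⇔∈⋃E : ∀ {β} → IsQZ β → χ β α ≡ 1ℚ ⇔ β ∈⋃E a
  χ≡1⇔∈⋃E {β} qz = by-cases (β ℚP.≟ 0ℚ)
    where
      by-cases : Dec (β ≡ 0ℚ) → χ β α ≡ 1ℚ ⇔ β ∈⋃E a
      by-cases (yes β≡0) = mk⇔ (const (subst (_∈⋃E a) (sym β≡0) 0∈⋃E)) (const (cong (λ b → χ b α) β≡0))
      by-cases (no β≢0) = mk⇔
        (λ χ≡1 → Descent.∈⋃E qz β≢0 par (to (χ≡1⇔Straddles qz β≢0 par) χ≡1))
        (λ { (suc n , _ , suc m , _ , sm≤a , e) → modOne-inter⇒χ≡1 qz β≢0 n m sm≤a e })
        where
          0<β = ≮∧≢⇒> (λ β<0 → <⇒≱ β<0 (proj₁ qz)) β≢0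
          par = sternBrocot-parents β 0<β (proj₂ qz)

  ∈filter-χ⇔ : ∀ Q β →
    β ∈ filter (λ γ → χ γ α ℚP.≟ 1ℚ) (farey Q) ⇔ (IsQZ β × height β ≤ Q × β ∈⋃E a)
  ∈filter-χ⇔ Q β = mk⇔ (λ m → sound (∈-filter⁻ χ≟1 {xs = farey Q} m)) complete
    where
      χ≟1 : ∀ γ → Dec (χ γ α ≡ 1ℚ)
      χ≟1 γ = χ γ α ℚP.≟ 1ℚ
      sound : β ∈ farey Q × χ β α ≡ 1ℚ → IsQZ β × height β ≤ Q × β ∈⋃E a
      sound (m , χ≡1) = qz , h≤Q , to (χ≡1⇔∈⋃E qz) χ≡1
        where qz = proj₁ (farey-sound {Q} m)
              h≤Q = proj₂ (farey-sound {Q} m)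
      complete : IsQZ β × height β ≤ Q × β ∈⋃E a → β ∈ filter χ≟1 (farey Q)
      complete (qz , h≤Q , e) = ∈-filter⁺ χ≟1 {xs = farey Q} (farey-complete qz h≤Q) (from (χ≡1⇔∈⋃E qz) e)

sumχ≡sumX : ∀ Q x → sumχ Q x ≡ sumX Q x
sumχ≡sumX Q x = sumℚ-concatMap (λ β → χ β x) (λ q → ofHeight (suc q)) (upTo Q)

theorem5 : (α : Point) (a : ℕ → ℕ) → IrrationalPoint α → IsCFExpansion a α →
    (∀ (β : ℚ) → IsQZ β → (χ β α ≡ 1ℚ ⇔ β ∈⋃E a))
    × (∀ (Q : ℕ) → 1 ≤ Q →
         (sumχ Q α ≡ sumX Q α)
         × ∃ λ (L : List ℚ) → Unique L
             × (∀ (β : ℚ) → (β ∈ L ⇔ (IsQZ β × height β ≤ Q × β ∈⋃E a)))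
             × (sumχ Q α ≡ (+ length L) / 1))
theorem5 α a irr cf = (λ β → χ≡1⇔∈⋃E) , λ Q _ →
  sumχ≡sumX Q α ,
  filter (λ β → χ β α ℚP.≟ 1ℚ) (farey Q) ,
  UniqueP.filter⁺ (λ β → χ β α ℚP.≟ 1ℚ) (farey-unique Q) ,
  ∈filter-χ⇔ Q ,
  sum-01≡count (λ β → χ β α) χ-0or1 (farey Q)
  where
    open Irrational α irr
    open ContinuedFraction a α irr cf
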